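{- Let $G$ be a graph with possible loops and let $W: v_0v_1\dots v_k$ be a closed walk in $G$ ($v_k=v_0$) of odd length $k>3$ such that the walk $v_0v_1\dots v_{k-1}$ has no strong chords, and such that $v_0$ and $v_{k-1}$ are the only vertices of $W$ that have loops. Then $G$ contains an induced subgraph belonging to $\mathcal F_2\cup\mathcal F_3\cup\mathcal F_4\cup\mathcal F_5\cup\mathcal F_6\cup\mathcal F_7$.
   Context: A graph with possible loops is an undirected graph in which each vertex may or may not carry a loop (a loop at $v$ is the edge $vv$). A strong chord of a (not necessarily closed) walk $v_0v_1\dots v_m$ is an edge $v_iv_j$ of $G$ (possibly a loop) such that $j-i$ is odd and $j-i\neq\pm1$ (difference computed in the integers). Induced subgraphs preserve loops. "The $n$-cycle" has vertices $0,\dots,n-1$ and edges $\{i,i+1\}$ mod $n$; each listed graph has exactly the stated edges and loops. $\mathcal F_2$: the $n$-cycle, $n\ge3$, $n\ne4$, no loops. $\mathcal F_3$: the $n$-cycle, $n\ge5$, loop only at $0$. $\mathcal F_4$: the $n$-cycle, $n\ge5$, loops exactly at $0$ and $n-1$. $\mathcal F_5$: the $n$-cycle, $n\ge6$ even, loop only at $0$, plus edges $\{0,i\}$ for all even $i$, $2\le i\le n-2$. $\mathcal F_6$: the $n$-cycle, $n\ge5$, loops exactly at $0$ and $n-1$, plus edges $\{0,i\}$ for all even $i$, $2\le i\le n-2$. $\mathcal F_7$: as $\mathcal F_6$, plus additionally the edges $\{n-1,m\}$ for all $m$ with $1\le m\le n-3$ and $n-1-m$ even. -}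

module Defs where

open import Data.Nat using (ℕ; zero; suc; _+_; _*_; _∸_; _≤_; _<_; _≡ᵇ_; _≤ᵇ_)
open import Data.Bool using (Bool; true; false; _∧_; _∨_; not)
open import Data.Fin using (Fin; toℕ)
open import Data.Product using (Σ; ∃; _×_; _,_)
open import Data.Sum using (_⊎_)
open import Relation.Binary.PropositionalEquality using (_≡_; _≢_)
open import Function.Definitions using (Injective)

-- A finite graph with possible loops on vertex set Fin n:
-- a symmetric Boolean adjacency matrix; adj v v ≡ true means v carries a loop.
record Graph (n : ℕ) : Set where
  field
    adj : Fin n → Fin n → Bool
    adj-sym : ∀ u v → adj u v ≡ adj v u
open Graph public

Odd : ℕ → Set
Odd m = Σ ℕ λ t → m ≡ suc (2 * t)

evenᵇ : ℕ → Bool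
evenᵇ zero = true
evenᵇ (suc m) = not (evenᵇ m)

-- A walk v_0 … v_k is given by w : ℕ → Fin n (only the values at i ≤ k matter).
IsWalk : ∀ {n} → Graph n → ℕ → (ℕ → Fin n) → Set
IsWalk G k w = ∀ i → i < k → adj G (w i) (w (suc i)) ≡ true

-- The walk w 0 … w m has no strong chord: no edge (possibly a loop)
-- between w i and w j with j - i odd and j - i ≠ 1 (taking i < j by symmetry).
NoStrongChord : ∀ {n} → Graph n → ℕ → (ℕ → Fin n) → Set
NoStrongChord G m w =
  ∀ i j → i < j → j ≤ m → Odd (j ∸ i) → (j ∸ i) ≢ 1 → adj G (w i) (w j) ≡ false

-- Model graphs on vertex set {0, …, N-1} (arguments are toℕ of vertices).
step : ℕ → ℕ → ℕ → Bool
step N a b = (suc a ≡ᵇ b) ∨ ((suc a ≡ᵇ N) ∧ (b ≡ᵇ 0))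

cyc : ℕ → ℕ → ℕ → Bool
cyc N a b = step N a b ∨ step N b a

loop0 : ℕ → ℕ → Bool
loop0 a b = (a ≡ᵇ 0) ∧ (b ≡ᵇ 0)

loopLast : ℕ → ℕ → ℕ → Bool
loopLast N a b = (a ≡ᵇ N ∸ 1) ∧ (b ≡ᵇ N ∸ 1)

spoke0 : ℕ → ℕ → ℕ → Bool
spoke0 N a b = (a ≡ᵇ 0) ∧ evenᵇ b ∧ (2 ≤ᵇ b) ∧ (b ≤ᵇ N ∸ 2)

hub0 : ℕ → ℕ → ℕ → Bool
hub0 N a b = spoke0 N a b ∨ spoke0 N b a

spokeLast : ℕ → ℕ → ℕ → Bool
spokeLast N a b = (a ≡ᵇ N ∸ 1) ∧ (1 ≤ᵇ b) ∧ (b ≤ᵇ N ∸ 3) ∧ evenᵇ (N ∸ 1 ∸ b)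

hubLast : ℕ → ℕ → ℕ → Bool
hubLast N a b = spokeLast N a b ∨ spokeLast N b a

data Family : Set where
  F2 F3 F4 F5 F6 F7 : Family

Admissible : Family → ℕ → Set
Admissible F2 N = 3 ≤ N × N ≢ 4
Admissible F3 N = 5 ≤ N
Admissible F4 N = 5 ≤ N
Admissible F5 N = 6 ≤ N × evenᵇ N ≡ true
Admissible F6 N = 5 ≤ N
Admissible F7 N = 5 ≤ N

model : Family → ℕ → ℕ → ℕ → Bool
model F2 N a b = cyc N a b
model F3 N a b = cyc N a b ∨ loop0 a b
model F4 N a b = cyc N a b ∨ loop0 a b ∨ loopLast N a b
model F5 N a b = cyc N a b ∨ loop0 a b ∨ hub0 N a b
model F6 N a b = cyc N a b ∨ loop0 a b ∨ loopLast N a b ∨ hub0 N a b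
model F7 N a b = cyc N a b ∨ loop0 a b ∨ loopLast N a b ∨ hub0 N a b ∨ hubLast N a b

HasInducedCopy : ∀ {n} → Graph n → Family → ℕ → Set
HasInducedCopy {n} G F N =
  Σ (Fin N → Fin n) λ f → Injective _≡_ _≡_ f ×
    (∀ a b → adj G (f a) (f b) ≡ model F N (toℕ a) (toℕ b))

HasForbidden : ∀ {n} → Graph n → Set
HasForbidden G = Σ Family λ F → Σ ℕ λ N → Admissible F N × HasInducedCopy G F N

-- Write k = 2M + 1 and K = 2M. Every coincidence or loop among the inner vertices
-- w 1, …, w (K-1) would create a strong chord, so they are loopless and distinct from the ends.
-- An inner chord is even (odd ones are strong); a shortest one closes an induced odd cycle (F2).
-- Without inner chords the only extra edges join w 0 or w K to even inner positions. If the
-- even neighbours of w 0 are not an initial run w 2, …, w (2s), two consecutive ones span an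
-- induced cycle looped only at w 0 (F3); by reversal the neighbours of w K form a final run
-- w (2r), …, w (K-2). Comparing s and r, a cycle through w 0, a subpath of the walk and w K
-- is of type F6 (overlapping fans), F7 (both fans complete) or F4 (separated fans).

module Submission where

open import Defs
open import Data.Bool using (Bool; true; false; T; _∧_; _∨_; not; if_then_else_)
open import Data.Bool.Properties using (not-involutive; ∧-zeroʳ; ∧-identityʳ; ∨-zeroʳ; ∨-identityʳ; ∨-comm; ∧-comm)
open import Data.Empty using (⊥-elim)
open import Data.Fin using (Fin; toℕ)
open import Data.Fin.Properties using (toℕ-injective; toℕ<n)
open import Data.Nat using (ℕ; zero; suc; _+_; _*_; _∸_; _≤_; _<_; _≡ᵇ_; _≤ᵇ_; _<ᵇ_; z≤n; s≤s; _≟_; _≤?_)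
open import Data.Nat.Properties
open import Data.Nat.Tactic.RingSolver using (solve-∀)
open import Data.Product using (∃; _×_; _,_; proj₁; proj₂)
open import Data.Sum using (_⊎_; inj₁; inj₂; [_,_]′)
open import Relation.Binary using (tri<; tri≈; tri>)
open import Relation.Binary.PropositionalEquality
open import Relation.Nullary using (¬_; yes; no)

T⇒≡true : ∀ {b} → T b → b ≡ true
T⇒≡true {true} _ = refl

¬T⇒≡false : ∀ {b} → ¬ T b → b ≡ false
¬T⇒≡false {false} _ = refl
¬T⇒≡false {true} ¬t = ⊥-elim (¬t _)

true≢false : ∀ {b} → b ≡ true → b ≢ false
true≢false refl ()

∧-true : ∀ a b → a ∧ b ≡ true → a ≡ true × b ≡ true
∧-true true true _ = refl , refl

∧-false⇒falseʳ : ∀ {a b} → a ≡ true → a ∧ b ≡ false → b ≡ false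
∧-false⇒falseʳ refl e = e

∧-falseʳ : ∀ a {b} → b ≡ false → a ∧ b ≡ false
∧-falseʳ a refl = ∧-zeroʳ a

≡ᵇ-refl : ∀ n → (n ≡ᵇ n) ≡ true
≡ᵇ-refl n = T⇒≡true (≡⇒≡ᵇ n n refl)

≢⇒≡ᵇ-false : ∀ {m n} → m ≢ n → (m ≡ᵇ n) ≡ false
≢⇒≡ᵇ-false {m} {n} m≢n = ¬T⇒≡false (λ t → m≢n (≡ᵇ⇒≡ m n t))

≤⇒≤ᵇ-true : ∀ {m n} → m ≤ n → (m ≤ᵇ n) ≡ true
≤⇒≤ᵇ-true m≤n = T⇒≡true (≤⇒≤ᵇ m≤n)

>⇒≤ᵇ-false : ∀ {m n} → n < m → (m ≤ᵇ n) ≡ false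
>⇒≤ᵇ-false {m} {n} n<m = ¬T⇒≡false (λ t → <⇒≱ n<m (≤ᵇ⇒≤ m n t))

<⇒<ᵇ-true : ∀ {m n} → m < n → (m <ᵇ n) ≡ true
<⇒<ᵇ-true m<n = T⇒≡true (<⇒<ᵇ m<n)

<ᵇ-true⇒< : ∀ {m n} → (m <ᵇ n) ≡ true → m < n
<ᵇ-true⇒< {m} {n} e = <ᵇ⇒< m n (subst T (sym e) _)

≤-split : ∀ {a b} → a ≤ b → ∃ λ c → b ≡ a + c
≤-split {a} {b} a≤b = b ∸ a , sym (m+[n∸m]≡n a≤b)

+-monoʳ-2+≤ : ∀ i {x y} → 2 + x ≤ y → 2 + (i + x) ≤ i + y
+-monoʳ-2+≤ i {x} {y} 2+x≤y = subst (_≤ i + y) (trans (+-suc i (suc x)) (cong suc (+-suc i x))) (+-monoʳ-≤ i 2+x≤y)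

≤ᵇ-double : ∀ a b → (2 * a ≤ᵇ 2 * b) ≡ (a ≤ᵇ b)
≤ᵇ-double a b with a ≤? b
... | yes a≤b = trans (≤⇒≤ᵇ-true (*-monoʳ-≤ 2 a≤b)) (sym (≤⇒≤ᵇ-true a≤b))
... | no a≰b = trans (>⇒≤ᵇ-false (*-monoʳ-< 2 (≰⇒> a≰b))) (sym (>⇒≤ᵇ-false (≰⇒> a≰b)))

even⊎odd : ∀ n → (∃ λ t → n ≡ 2 * t) ⊎ (∃ λ t → n ≡ suc (2 * t))
even⊎odd zero = inj₁ (0 , refl)
even⊎odd (suc n) with even⊎odd n
... | inj₁ (t , refl) = inj₂ (t , refl)
... | inj₂ (t , refl) = inj₁ (suc t , cong suc (sym (+-suc t (t + 0))))

evenᵇ-double : ∀ t → evenᵇ (2 * t) ≡ true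
evenᵇ-double zero = refl
evenᵇ-double (suc t) rewrite +-suc t (t + 0) = trans (not-involutive (evenᵇ (2 * t))) (evenᵇ-double t)

evenᵇ-suc-double : ∀ t → evenᵇ (suc (2 * t)) ≡ false
evenᵇ-suc-double t rewrite evenᵇ-double t = refl

evenᵇ-+ : ∀ a b → evenᵇ (a + b) ≡ (if evenᵇ a then evenᵇ b else not (evenᵇ b))
evenᵇ-+ zero b = refl
evenᵇ-+ (suc a) b with evenᵇ a | evenᵇ-+ a b
... | true | e = cong not e
... | false | e = trans (cong not e) (not-involutive (evenᵇ b))

evenᵇ-∸-double : ∀ M j → j ≤ 2 * M → evenᵇ (2 * M ∸ j) ≡ evenᵇ j
evenᵇ-∸-double M j j≤ = parities-agree (evenᵇ j) (evenᵇ (2 * M ∸ j))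
  (trans (sym (evenᵇ-+ j (2 * M ∸ j))) (trans (cong evenᵇ (m+[n∸m]≡n j≤)) (evenᵇ-double M)))
  where
  parities-agree : ∀ a b → (if a then b else not b) ≡ true → b ≡ a
  parities-agree true true _ = refl
  parities-agree false false _ = refl

evenᵇ-∧-≤ᵇ-double : ∀ j c → j ≤ suc (2 * c) → (evenᵇ j ∧ (j ≤ᵇ 2 * c)) ≡ evenᵇ j
evenᵇ-∧-≤ᵇ-double j c j≤1+2c with m≤n⇒m<n∨m≡n j≤1+2c
... | inj₁ j<1+2c = trans (cong (evenᵇ j ∧_) (≤⇒≤ᵇ-true (≤-pred j<1+2c))) (∧-identityʳ _)
... | inj₂ refl rewrite evenᵇ-suc-double c = refl

evenᵇ-∧-2≤ᵇ : ∀ j → 1 ≤ j → (evenᵇ j ∧ (2 ≤ᵇ j)) ≡ evenᵇ j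
evenᵇ-∧-2≤ᵇ (suc zero) _ = refl
evenᵇ-∧-2≤ᵇ (suc (suc j)) _ = ∧-identityʳ _

<⇒≤∸1 : ∀ {y N} → y < N → y ≤ N ∸ 1
<⇒≤∸1 {N = suc N} (s≤s y≤N) = y≤N

<∧≢∸1⇒≤∸2 : ∀ {y N} → y < N → y ≢ N ∸ 1 → y ≤ N ∸ 2
<∧≢∸1⇒≤∸2 {y} {suc N} (s≤s y≤N) y≢N with m≤n⇒m<n∨m≡n y≤N
... | inj₁ y<N = <⇒≤∸1 y<N
... | inj₂ y≡N = ⊥-elim (y≢N y≡N)

∸-∸-reverse : ∀ {i j K} → i ≤ j → j ≤ K → (K ∸ i) ∸ (K ∸ j) ≡ j ∸ i
∸-∸-reverse {i} {j} {K} i≤j j≤K = begin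
  (K ∸ i) ∸ (K ∸ j)             ≡⟨ cong (λ m → (m ∸ i) ∸ (K ∸ j)) (sym (m+[n∸m]≡n j≤K)) ⟩
  (j + (K ∸ j) ∸ i) ∸ (K ∸ j)   ≡⟨ cong (_∸ (K ∸ j)) (+-∸-comm (K ∸ j) i≤j) ⟩
  ((j ∸ i) + (K ∸ j)) ∸ (K ∸ j) ≡⟨ m+n∸n≡m (j ∸ i) (K ∸ j) ⟩
  j ∸ i                         ∎
  where open ≡-Reasoning

∸-≤-swap : ∀ M u s → M ∸ u ≤ s → M ∸ s ≤ u
∸-≤-swap M u s M∸u≤s =
  m≤n+o⇒m∸n≤o M s (subst (M ≤_) (+-comm u s) (≤-trans (m≤n+m∸n M u) (+-monoʳ-≤ u M∸u≤s)))

∸-≤ᵇ-swap : ∀ M u s → ((M ∸ u) ≤ᵇ s) ≡ ((M ∸ s) ≤ᵇ u)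
∸-≤ᵇ-swap M u s with (M ∸ u) ≤? s
... | yes M∸u≤s = trans (≤⇒≤ᵇ-true M∸u≤s) (sym (≤⇒≤ᵇ-true (∸-≤-swap M u s M∸u≤s)))
... | no M∸u≰s =
  trans (>⇒≤ᵇ-false (≰⇒> M∸u≰s)) (sym (>⇒≤ᵇ-false (≰⇒> (λ M∸s≤u → M∸u≰s (∸-≤-swap M s u M∸s≤u)))))

∸≡1⇒≡∸1 : ∀ {M s} → s ≤ M → M ∸ s ≡ 1 → s ≡ M ∸ 1
∸≡1⇒≡∸1 {M} s≤M M∸s≡1 = trans (sym (m∸[m∸n]≡n s≤M)) (cong (M ∸_) M∸s≡1)

injective-from-< : ∀ {A : Set} (g : ℕ → A) N → (∀ x y → x < y → y < N → g x ≢ g y) →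
  ∀ x y → x < N → y < N → g x ≡ g y → x ≡ y
injective-from-< g N distinct x y x<N y<N gx≡gy with <-cmp x y
... | tri< x<y _ _ = ⊥-elim (distinct x y x<y y<N gx≡gy)
... | tri≈ _ x≡y _ = x≡y
... | tri> _ _ y<x = ⊥-elim (distinct y x y<x x<N (sym gx≡gy))

allFalse⊎someTrue : (f : ℕ → Bool) (B : ℕ) → (∀ i → i < B → f i ≡ false) ⊎ ∃ λ i → f i ≡ true
allFalse⊎someTrue f zero = inj₁ (λ i ())
allFalse⊎someTrue f (suc B) with allFalse⊎someTrue f B | f B in fB
... | inj₂ found | _ = inj₂ found
... | inj₁ _ | true = inj₂ (B , fB)
... | inj₁ below | false = inj₁ λ i i<1+B → [ below i , (λ { refl → fB }) ]′ (m≤n⇒m<n∨m≡n (≤-pred i<1+B))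

cyc-sym : ∀ N a b → cyc N a b ≡ cyc N b a
cyc-sym N a b = ∨-comm (step N a b) (step N b a)

loop0-sym : ∀ a b → loop0 a b ≡ loop0 b a
loop0-sym a b = ∧-comm (a ≡ᵇ 0) (b ≡ᵇ 0)

loopLast-sym : ∀ N a b → loopLast N a b ≡ loopLast N b a
loopLast-sym N a b = ∧-comm (a ≡ᵇ N ∸ 1) (b ≡ᵇ N ∸ 1)

hub0-sym : ∀ N a b → hub0 N a b ≡ hub0 N b a
hub0-sym N a b = ∨-comm (spoke0 N a b) (spoke0 N b a)

hubLast-sym : ∀ N a b → hubLast N a b ≡ hubLast N b a
hubLast-sym N a b = ∨-comm (spokeLast N a b) (spokeLast N b a)

model-sym : ∀ F N a b → model F N a b ≡ model F N b a
model-sym F2 N a b = cyc-sym N a b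
model-sym F3 N a b = cong₂ _∨_ (cyc-sym N a b) (loop0-sym a b)
model-sym F4 N a b = cong₂ _∨_ (cyc-sym N a b) (cong₂ _∨_ (loop0-sym a b) (loopLast-sym N a b))
model-sym F5 N a b = cong₂ _∨_ (cyc-sym N a b) (cong₂ _∨_ (loop0-sym a b) (hub0-sym N a b))
model-sym F6 N a b = cong₂ _∨_ (cyc-sym N a b)
  (cong₂ _∨_ (loop0-sym a b) (cong₂ _∨_ (loopLast-sym N a b) (hub0-sym N a b)))
model-sym F7 N a b = cong₂ _∨_ (cyc-sym N a b)
  (cong₂ _∨_ (loop0-sym a b) (cong₂ _∨_ (loopLast-sym N a b) (cong₂ _∨_ (hub0-sym N a b) (hubLast-sym N a b))))

cyc⇒model : ∀ F N a b → cyc N a b ≡ true → model F N a b ≡ true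
cyc⇒model F2 N a b e = e
cyc⇒model F3 N a b e rewrite e = refl
cyc⇒model F4 N a b e rewrite e = refl
cyc⇒model F5 N a b e rewrite e = refl
cyc⇒model F6 N a b e rewrite e = refl
cyc⇒model F7 N a b e rewrite e = refl

cyc-suc : ∀ N x → cyc N x (suc x) ≡ true
cyc-suc N x rewrite ≡ᵇ-refl x = refl

cyc-wrap : ∀ N → cyc (suc N) 0 N ≡ true
cyc-wrap N rewrite ≡ᵇ-refl N = ∨-zeroʳ (step (suc N) 0 N)

cyc-irrefl : ∀ N x → 3 ≤ N → cyc N x x ≡ false
cyc-irrefl N zero 3≤N rewrite ≢⇒≡ᵇ-false {1} {N} (λ { refl → <⇒≱ 3≤N (s≤s z≤n) }) = refl
cyc-irrefl N (suc x) 3≤N rewrite ≢⇒≡ᵇ-false {suc x} {x} (1+n≢n {x}) | ∧-zeroʳ (suc (suc x) ≡ᵇ N) = refl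

NonConsecutive : ℕ → ℕ → ℕ → Set
NonConsecutive N x y = 2 + x ≤ y × y < N × (x ≡ 0 → y ≢ N ∸ 1)

module _ {N x y : ℕ} (nc : NonConsecutive N x y) where

  private
    2+x≤y : 2 + x ≤ y
    2+x≤y = proj₁ nc

    y<N : y < N
    y<N = proj₁ (proj₂ nc)

  nonConsecutive⇒<N∸1 : x < N ∸ 1
  nonConsecutive⇒<N∸1 = ≤-trans (s≤s (n≤1+n x)) (≤-trans 2+x≤y (<⇒≤∸1 y<N))

  cyc-nonConsecutive : cyc N x y ≡ false
  cyc-nonConsecutive
    rewrite ≢⇒≡ᵇ-false {suc x} {y} (λ e → <-irrefl e 2+x≤y)
          | ≢⇒≡ᵇ-false {suc x} {N} (λ e → <-irrefl e (<-trans 2+x≤y y<N))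
          | ≢⇒≡ᵇ-false {suc y} {x} (λ e → <-irrefl (sym e) (s≤s (≤-trans (≤-trans (n≤1+n x) (n≤1+n (suc x))) 2+x≤y)))
          = wrap x (proj₂ (proj₂ nc))
    where
    wrap : ∀ x → (x ≡ 0 → y ≢ N ∸ 1) → ((suc y ≡ᵇ N) ∧ (x ≡ᵇ 0)) ≡ false
    wrap zero not-wrap rewrite ≢⇒≡ᵇ-false {suc y} {N} (λ { refl → not-wrap refl refl }) = refl
    wrap (suc x) _ = ∧-zeroʳ (suc y ≡ᵇ N)

loop0-nonConsecutive : ∀ {N x y} → NonConsecutive N x y → loop0 x y ≡ false
loop0-nonConsecutive {y = suc (suc y)} _ = ∧-zeroʳ _
loop0-nonConsecutive {y = suc zero} (s≤s () , _)

loopLast-nonConsecutive : ∀ {N x y} → NonConsecutive N x y → loopLast N x y ≡ false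
loopLast-nonConsecutive {N} {x} nc
  rewrite ≢⇒≡ᵇ-false {x} {N ∸ 1} (λ e → <-irrefl e (nonConsecutive⇒<N∸1 nc)) = refl

hub0-nonConsecutive-zero : ∀ {N y} → NonConsecutive N 0 y → hub0 N 0 y ≡ evenᵇ y
hub0-nonConsecutive-zero {N} {suc (suc y)} (_ , y<N , not-wrap)
  rewrite ≤⇒≤ᵇ-true {suc (suc y)} {N ∸ 2} (<∧≢∸1⇒≤∸2 y<N (not-wrap refl))
  = trans (∨-identityʳ _) (∧-identityʳ _)
hub0-nonConsecutive-zero {y = suc zero} (s≤s () , _)

hub0-nonConsecutive-suc : ∀ {N x y} → NonConsecutive N (suc x) y → hub0 N (suc x) y ≡ false
hub0-nonConsecutive-suc {y = suc (suc y)} _ = refl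
hub0-nonConsecutive-suc {y = suc zero} (s≤s () , _)

hubLast-nonConsecutive : ∀ {N x y} → NonConsecutive N x y → y ≢ N ∸ 1 → hubLast N x y ≡ false
hubLast-nonConsecutive {N} {x} {y} nc y≢N∸1
  rewrite ≢⇒≡ᵇ-false {x} {N ∸ 1} (λ e → <-irrefl e (nonConsecutive⇒<N∸1 nc))
        | ≢⇒≡ᵇ-false {y} {N ∸ 1} y≢N∸1 = refl

hubLast-nonConsecutive-last : ∀ {N x} → NonConsecutive N (suc x) (N ∸ 1) →
  hubLast N (suc x) (N ∸ 1) ≡ evenᵇ (N ∸ 1 ∸ suc x)
hubLast-nonConsecutive-last {N} {x} nc
  rewrite ≢⇒≡ᵇ-false {suc x} {N ∸ 1} (λ e → <-irrefl e (nonConsecutive⇒<N∸1 nc))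
        | ≡ᵇ-refl (N ∸ 1)
        | ≤⇒≤ᵇ-true {suc x} {N ∸ 3} (subst (suc x ≤_) (∸-+-assoc N 1 2) (∸-monoˡ-≤ 2 (proj₁ nc)))
  = refl

model-F3-nonConsecutive : ∀ {N x y} → NonConsecutive N x y → model F3 N x y ≡ false
model-F3-nonConsecutive nc rewrite cyc-nonConsecutive nc | loop0-nonConsecutive nc = refl

model-F4-nonConsecutive : ∀ {N x y} → NonConsecutive N x y → model F4 N x y ≡ false
model-F4-nonConsecutive nc
  rewrite cyc-nonConsecutive nc | loop0-nonConsecutive nc | loopLast-nonConsecutive nc = refl

∨-identityˡ³ : ∀ {a b c} d → a ≡ false → b ≡ false → c ≡ false → (a ∨ (b ∨ (c ∨ d))) ≡ d
∨-identityˡ³ d refl refl refl = refl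

model-F6-nonConsecutive-zero : ∀ {N y} → NonConsecutive N 0 y → model F6 N 0 y ≡ evenᵇ y
model-F6-nonConsecutive-zero nc =
  trans (∨-identityˡ³ _ (cyc-nonConsecutive nc) (loop0-nonConsecutive nc) (loopLast-nonConsecutive nc))
        (hub0-nonConsecutive-zero nc)

model-F6-nonConsecutive-suc : ∀ {N x y} → NonConsecutive N (suc x) y → model F6 N (suc x) y ≡ false
model-F6-nonConsecutive-suc nc =
  trans (∨-identityˡ³ _ (cyc-nonConsecutive nc) (loop0-nonConsecutive nc) (loopLast-nonConsecutive nc))
        (hub0-nonConsecutive-suc nc)

model-F7-nonConsecutive-zero : ∀ {N y} → NonConsecutive N 0 y → model F7 N 0 y ≡ evenᵇ y
model-F7-nonConsecutive-zero nc =
  trans (∨-identityˡ³ _ (cyc-nonConsecutive nc) (loop0-nonConsecutive nc) (loopLast-nonConsecutive nc))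
        (trans (cong₂ _∨_ (hub0-nonConsecutive-zero nc) (hubLast-nonConsecutive nc (proj₂ (proj₂ nc) refl)))
               (∨-identityʳ _))

model-F7-nonConsecutive-suc : ∀ {N x y} → NonConsecutive N (suc x) y →
  model F7 N (suc x) y ≡ hubLast N (suc x) y
model-F7-nonConsecutive-suc {N} {x} {y} nc =
  trans (∨-identityˡ³ _ (cyc-nonConsecutive nc) (loop0-nonConsecutive nc) (loopLast-nonConsecutive nc))
        (cong (_∨ hubLast N (suc x) y) (hub0-nonConsecutive-suc nc))

model-loop-first : ∀ F N → 3 ≤ N → F ≢ F2 → model F N 0 0 ≡ true
model-loop-first F2 N _ F≢F2 = ⊥-elim (F≢F2 refl)
model-loop-first F3 N 3≤N _ rewrite cyc-irrefl N 0 3≤N = refl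
model-loop-first F4 N 3≤N _ rewrite cyc-irrefl N 0 3≤N = refl
model-loop-first F5 N 3≤N _ rewrite cyc-irrefl N 0 3≤N = refl
model-loop-first F6 N 3≤N _ rewrite cyc-irrefl N 0 3≤N = refl
model-loop-first F7 N 3≤N _ rewrite cyc-irrefl N 0 3≤N = refl

model-F3-loop-suc : ∀ N x → 3 ≤ N → model F3 N (suc x) (suc x) ≡ false
model-F3-loop-suc N x 3≤N rewrite cyc-irrefl N (suc x) 3≤N = refl

data Bilooped : Family → Set where
  F4-bilooped : Bilooped F4
  F6-bilooped : Bilooped F6
  F7-bilooped : Bilooped F7

model-loop-last : ∀ {F} → Bilooped F → ∀ N → 3 ≤ N → model F N (N ∸ 1) (N ∸ 1) ≡ true
model-loop-last F4-bilooped N 3≤N@(s≤s (s≤s (s≤s _))) rewrite cyc-irrefl N (N ∸ 1) 3≤N | ≡ᵇ-refl (N ∸ 1) = refl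
model-loop-last F6-bilooped N 3≤N@(s≤s (s≤s (s≤s _))) rewrite cyc-irrefl N (N ∸ 1) 3≤N | ≡ᵇ-refl (N ∸ 1) = refl
model-loop-last F7-bilooped N 3≤N@(s≤s (s≤s (s≤s _))) rewrite cyc-irrefl N (N ∸ 1) 3≤N | ≡ᵇ-refl (N ∸ 1) = refl

model-loop-inner : ∀ {F} → Bilooped F → ∀ N x → 3 ≤ N → suc x < N ∸ 1 → model F N (suc x) (suc x) ≡ false
model-loop-inner F4-bilooped N x 3≤N x<N∸1
  rewrite cyc-irrefl N (suc x) 3≤N | ≢⇒≡ᵇ-false {suc x} {N ∸ 1} (λ e → <-irrefl e x<N∸1) = refl
model-loop-inner F6-bilooped N x 3≤N x<N∸1
  rewrite cyc-irrefl N (suc x) 3≤N | ≢⇒≡ᵇ-false {suc x} {N ∸ 1} (λ e → <-irrefl e x<N∸1) = refl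
model-loop-inner F7-bilooped N x 3≤N x<N∸1
  rewrite cyc-irrefl N (suc x) 3≤N | ≢⇒≡ᵇ-false {suc x} {N ∸ 1} (λ e → <-irrefl e x<N∸1) = refl

model-inner-nonConsecutive : ∀ {F N x y} → Bilooped F → NonConsecutive N (suc x) y → y ≢ N ∸ 1 →
  model F N (suc x) y ≡ false
model-inner-nonConsecutive F4-bilooped nc _ = model-F4-nonConsecutive nc
model-inner-nonConsecutive F6-bilooped nc _ = model-F6-nonConsecutive-suc nc
model-inner-nonConsecutive F7-bilooped nc y≢N∸1 =
  trans (model-F7-nonConsecutive-suc nc) (hubLast-nonConsecutive nc y≢N∸1)

module _ {n} (G : Graph n) (F : Family) (N : ℕ) (g : ℕ → Fin n) (3≤N : 3 ≤ N)
  (g-injective : ∀ x y → x < N → y < N → g x ≡ g y → x ≡ y)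
  (g-edge : ∀ x → suc x < N → adj G (g x) (g (suc x)) ≡ true)
  (g-close : adj G (g 0) (g (N ∸ 1)) ≡ true)
  (g-loop : ∀ x → x < N → adj G (g x) (g x) ≡ model F N x x)
  (g-nonConsecutive : ∀ x y → NonConsecutive N x y → adj G (g x) (g y) ≡ model F N x y) where

  private
    adj-ordered : ∀ x y → x < y → y < N → adj G (g x) (g y) ≡ model F N x y
    adj-ordered x y x<y y<N with m≤n⇒m<n∨m≡n x<y
    ... | inj₂ refl = trans (g-edge x y<N) (sym (cyc⇒model F N x (suc x) (cyc-suc N x)))
    ... | inj₁ 2+x≤y with x ≟ 0 | y ≟ N ∸ 1
    ... | yes refl | yes refl = trans g-close (sym (wrap N 3≤N))
      where
      wrap : ∀ N → 3 ≤ N → model F N 0 (N ∸ 1) ≡ true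
      wrap (suc N) _ = cyc⇒model F (suc N) 0 N (cyc-wrap N)
    ... | yes refl | no y≢N∸1 = g-nonConsecutive 0 y (2+x≤y , y<N , λ _ → y≢N∸1)
    ... | no x≢0 | _ = g-nonConsecutive x y (2+x≤y , y<N , λ x≡0 → ⊥-elim (x≢0 x≡0))

    f : Fin N → Fin n
    f a = g (toℕ a)

    f-injective : ∀ {a b} → f a ≡ f b → a ≡ b
    f-injective {a} {b} e = toℕ-injective (g-injective (toℕ a) (toℕ b) (toℕ<n a) (toℕ<n b) e)

    f-adj : ∀ a b → adj G (f a) (f b) ≡ model F N (toℕ a) (toℕ b)
    f-adj a b with <-cmp (toℕ a) (toℕ b)
    ... | tri< a<b _ _ = adj-ordered (toℕ a) (toℕ b) a<b (toℕ<n b)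
    ... | tri≈ _ a≡b _ rewrite toℕ-injective a≡b = g-loop (toℕ b) (toℕ<n b)
    ... | tri> _ _ b<a = trans (adj-sym G (f a) (f b))
                           (trans (adj-ordered (toℕ b) (toℕ a) b<a (toℕ<n a)) (model-sym F N (toℕ b) (toℕ a)))

  inducedCopy-fromCycle : HasInducedCopy G F N
  inducedCopy-fromCycle = f , f-injective , f-adj

-- The walk w 0 … w (2M) closed up by the edge w (2M) w 0, i.e. the closed walk of odd length
-- k = 2M + 1 of the statement with its last vertex w k = w 0 dropped.
record EndLoopedWalk {n} (G : Graph n) (M : ℕ) (w : ℕ → Fin n) : Set where
  field
    edge : ∀ i → i < 2 * M → adj G (w i) (w (suc i)) ≡ true
    close : adj G (w 0) (w (2 * M)) ≡ true
    noStrongChord : NoStrongChord G (2 * M) w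
    loop-first : adj G (w 0) (w 0) ≡ true
    loop-last : adj G (w (2 * M)) (w (2 * M)) ≡ true
    loops-at-ends : ∀ i → i ≤ 2 * M → adj G (w i) (w i) ≡ true → w i ≡ w 0 ⊎ w i ≡ w (2 * M)

reverseWalk : ∀ {n} {G : Graph n} {M} {w : ℕ → Fin n} → EndLoopedWalk G M w →
  EndLoopedWalk G M (λ i → w (2 * M ∸ i))
reverseWalk {n} {G} {M} {w} W = record
  { edge = edge′
  ; close = subst (λ z → adj G (w (2 * M)) (w z) ≡ true) (sym (n∸n≡0 K)) (trans (adj-sym G _ _) close)
  ; noStrongChord = noStrongChord′
  ; loop-first = loop-last
  ; loop-last = subst (λ z → adj G (w z) (w z) ≡ true) (sym (n∸n≡0 K)) loop-first
  ; loops-at-ends = loops-at-ends′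
  }
  where
  open EndLoopedWalk W

  K : ℕ
  K = 2 * M

  edge′ : ∀ i → i < K → adj G (w (K ∸ i)) (w (K ∸ suc i)) ≡ true
  edge′ i i<K rewrite +-∸-assoc 1 i<K =
    trans (adj-sym G _ _) (edge (K ∸ suc i) (∸-monoʳ-< (s≤s z≤n) i<K))

  noStrongChord′ : NoStrongChord G K (λ i → w (K ∸ i))
  noStrongChord′ i j i<j j≤K odd ≢1 =
    trans (adj-sym G _ _)
      (noStrongChord (K ∸ j) (K ∸ i) (∸-monoʳ-< i<j j≤K) (m∸n≤m K i)
        (subst Odd (sym distance) odd) (λ e → ≢1 (trans (sym distance) e)))
    where
    distance : (K ∸ i) ∸ (K ∸ j) ≡ j ∸ i
    distance = ∸-∸-reverse (<⇒≤ i<j) j≤K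

  loops-at-ends′ : ∀ i → i ≤ K → adj G (w (K ∸ i)) (w (K ∸ i)) ≡ true →
    w (K ∸ i) ≡ w (K ∸ 0) ⊎ w (K ∸ i) ≡ w (K ∸ K)
  loops-at-ends′ i _ loop with loops-at-ends (K ∸ i) (m∸n≤m K i) loop
  ... | inj₁ e = inj₂ (trans e (cong w (sym (n∸n≡0 K))))
  ... | inj₂ e = inj₁ e

module EndFacts {n} {G : Graph n} {M} (2≤M : 2 ≤ M) {w : ℕ → Fin n} (W : EndLoopedWalk G M w) where
  open EndLoopedWalk W public

  K : ℕ
  K = 2 * M

  4≤K : 4 ≤ K
  4≤K = *-monoʳ-≤ 2 2≤M

  1+3+2[M∸2]≡K : 1 + (3 + 2 * (M ∸ 2)) ≡ K
  1+3+2[M∸2]≡K with ≤-split 2≤M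
  ... | M′ , refl = identity M′
    where
    identity : ∀ M′ → 1 + (3 + 2 * M′) ≡ 2 * (2 + M′)
    identity = solve-∀

  edge-first : adj G (w 0) (w 1) ≡ true
  edge-first = edge 0 (≤-trans (s≤s z≤n) 4≤K)

  noOddChord : ∀ i t j → i + (3 + 2 * t) ≡ j → j ≤ K → adj G (w i) (w j) ≡ false
  noOddChord i t j refl j≤K =
    noStrongChord i j (m<m+n i (s≤s z≤n) ) j≤K
      (subst Odd (sym (m+n∸m≡n i (3 + 2 * t))) (suc t , odd t))
      (λ e → 3+2t≢1 (trans (sym (m+n∸m≡n i (3 + 2 * t))) e))
    where
    odd : ∀ t → 3 + 2 * t ≡ suc (2 * suc t)
    odd = solve-∀
    3+2t≢1 : 3 + 2 * t ≢ 1
    3+2t≢1 ()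

  -- Identifying w j with w 0 turns the loop at w 0, or an edge of w 0 to w 1 or w K,
  -- into a strong chord.
  inner≢first : ∀ j → 1 ≤ j → j < K → w j ≢ w 0
  inner≢first j 1≤j j<K wj≡w0 with even⊎odd j
  ... | inj₂ (zero , refl) =
    true≢false (subst (λ z → adj G z (w K) ≡ true) (sym wj≡w0) close)
               (noOddChord 1 (M ∸ 2) K 1+3+2[M∸2]≡K ≤-refl)
  ... | inj₂ (suc t , refl) =
    true≢false (subst (λ z → adj G (w 0) z ≡ true) (sym wj≡w0) loop-first)
               (noOddChord 0 t j (odd t) (<⇒≤ j<K))
    where
    odd : ∀ t → 3 + 2 * t ≡ suc (2 * suc t)
    odd = solve-∀
  ... | inj₁ (suc zero , refl) =
    true≢false (subst (λ z → adj G z (w 3) ≡ true) wj≡w0 (edge 2 (≤-trans (s≤s (s≤s (s≤s z≤n))) 4≤K)))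
               (noOddChord 0 0 3 refl (≤-trans (s≤s (s≤s (s≤s z≤n))) 4≤K))
  ... | inj₁ (suc (suc t) , refl) =
    true≢false (subst (λ z → adj G (w 1) z ≡ true) (sym wj≡w0) (trans (adj-sym G _ _) edge-first))
               (noOddChord 1 t j (even t) (<⇒≤ j<K))
    where
    even : ∀ t → 1 + (3 + 2 * t) ≡ 2 * suc (suc t)
    even = solve-∀

  first≢last : w 0 ≢ w K
  first≢last w0≡wK =
    true≢false (subst (λ z → adj G (w 1) z ≡ true) w0≡wK (trans (adj-sym G _ _) edge-first))
               (noOddChord 1 (M ∸ 2) K 1+3+2[M∸2]≡K ≤-refl)

module InnerFacts {n} {G : Graph n} {M} (2≤M : 2 ≤ M) {w : ℕ → Fin n} (W : EndLoopedWalk G M w) where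
  open EndFacts 2≤M W public
  private
    module Reversed = EndFacts 2≤M (reverseWalk W)

  inner≢last : ∀ j → 1 ≤ j → j < K → w j ≢ w K
  inner≢last j 1≤j j<K wj≡wK =
    Reversed.inner≢first (K ∸ j) (m<n⇒0<n∸m j<K) (∸-monoʳ-< 1≤j (<⇒≤ j<K))
      (trans (cong w (m∸[m∸n]≡n (<⇒≤ j<K))) wj≡wK)

  inner-loopless : ∀ j → 1 ≤ j → j < K → adj G (w j) (w j) ≡ false
  inner-loopless j 1≤j j<K = ¬T⇒≡false no-loop
    where
    no-loop : ¬ T (adj G (w j) (w j))
    no-loop loop with loops-at-ends j (<⇒≤ j<K) (T⇒≡true loop)
    ... | inj₁ e = inner≢first j 1≤j j<K e
    ... | inj₂ e = inner≢last j 1≤j j<K e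

module InnerChords {n} {G : Graph n} {M} (2≤M : 2 ≤ M) {w : ℕ → Fin n} (W : EndLoopedWalk G M w) where
  open InnerFacts 2≤M W public

  ShortInnerChordless : ℕ → Set
  ShortInnerChordless D = ∀ i j → 1 ≤ i → 2 + i ≤ j → j < K → j < i + D → adj G (w i) (w j) ≡ false

  InnerChordless : Set
  InnerChordless = ∀ i j → 1 ≤ i → 2 + i ≤ j → j < K → adj G (w i) (w j) ≡ false

  -- A coincidence w i = w j turns the edge from w j to one of its walk neighbours into a chord
  -- from w i which is either odd, hence strong, or an inner chord shorter than j - i.
  inner-injective : ∀ {D} → ShortInnerChordless D →
    ∀ i j → 1 ≤ i → i < j → j < K → j ≤ i + D → w i ≢ w j
  inner-injective chordless i (suc j) 1≤i (s≤s i≤j) 1+j<K 1+j≤i+D wi≡w1+j with m≤n⇒m<n∨m≡n i≤j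
  ... | inj₂ refl =
    true≢false (subst (λ z → adj G (w i) z ≡ true) (sym wi≡w1+j) (edge i (<⇒≤ 1+j<K)))
               (inner-loopless i 1≤i (<-trans (n<1+n i) 1+j<K))
  ... | inj₁ i<j with ≤-split i<j
  ...   | c , refl with even⊎odd c
  ...     | inj₁ (s , refl) =
    true≢false (subst (λ z → adj G z (w (2 + j)) ≡ true) (sym wi≡w1+j) (edge (suc j) 1+j<K))
               (noOddChord i s (2 + j) (odd-length i s) 1+j<K)
    where
    odd-length : ∀ i s → i + (3 + 2 * s) ≡ 2 + (suc i + 2 * s)
    odd-length = solve-∀
  ...     | inj₂ (s , refl) =
    true≢false (subst (λ z → adj G z (w j) ≡ true) (sym wi≡w1+j) (trans (adj-sym G _ _) (edge j (<⇒≤ 1+j<K))))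
               (chordless i j 1≤i 2+i≤j (<-trans (n<1+n j) 1+j<K) 1+j≤i+D)
    where
    2+i≤j : 2 + i ≤ suc i + suc (2 * s)
    2+i≤j = subst (2 + i ≤_) (sym (+-suc (suc i) (2 * s))) (s≤s (s≤s (m≤m+n i _)))

  forbidden-fromShortestChord : ∀ i t → 1 ≤ i → i + (2 + 2 * t) < K →
    ShortInnerChordless (2 + 2 * t) → adj G (w i) (w (i + (2 + 2 * t))) ≡ true → HasForbidden G
  forbidden-fromShortestChord i t 1≤i i+D<K chordless chord =
    F2 , N , (s≤s (s≤s (s≤s z≤n)) , N≢4) ,
    inducedCopy-fromCycle G F2 N g (s≤s (s≤s (s≤s z≤n)))
      (injective-from-< g N distinct) g-edge g-close g-loop g-nonConsecutive
    where
    D : ℕ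
    D = 2 + 2 * t
    N : ℕ
    N = suc D

    N≢4 : N ≢ 4
    N≢4 e = even≢odd t 0 (+-cancelˡ-≡ 3 _ _ e)

    g : ℕ → Fin n
    g x = w (i + x)

    i+x<K : ∀ {x} → x < N → i + x < K
    i+x<K x<N = ≤-<-trans (+-monoʳ-≤ i (≤-pred x<N)) i+D<K

    1≤i+x : ∀ x → 1 ≤ i + x
    1≤i+x x = ≤-trans 1≤i (m≤m+n i x)

    distinct : ∀ x y → x < y → y < N → g x ≢ g y
    distinct x y x<y y<N = inner-injective chordless (i + x) (i + y) (1≤i+x x) (+-monoʳ-< i x<y) (i+x<K y<N)
      (subst (i + y ≤_) (sym (+-assoc i x D)) (+-monoʳ-≤ i (≤-trans (≤-pred y<N) (m≤n+m D x))))

    g-edge : ∀ x → suc x < N → adj G (g x) (g (suc x)) ≡ true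
    g-edge x 1+x<N rewrite +-suc i x = edge (i + x) (i+x<K (<-trans (n<1+n x) 1+x<N))

    g-close : adj G (g 0) (g (N ∸ 1)) ≡ true
    g-close rewrite +-identityʳ i = chord

    g-loop : ∀ x → x < N → adj G (g x) (g x) ≡ model F2 N x x
    g-loop x x<N = trans (inner-loopless (i + x) (1≤i+x x) (i+x<K x<N)) (sym (cyc-irrefl N x (s≤s (s≤s (s≤s z≤n)))))

    g-nonConsecutive : ∀ x y → NonConsecutive N x y → adj G (g x) (g y) ≡ model F2 N x y
    g-nonConsecutive x y nc@(2+x≤y , y<N , not-wrap) =
      trans (chordless (i + x) (i + y) (1≤i+x x) (+-monoʳ-2+≤ i 2+x≤y)
                       (i+x<K y<N) (subst (i + y <_) (sym (+-assoc i x D)) (+-monoʳ-< i (y<x+D x not-wrap))))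
            (sym (cyc-nonConsecutive nc))
      where
      y<x+D : ∀ x → (x ≡ 0 → y ≢ D) → y < x + D
      y<x+D zero not-last = ≤∧≢⇒< (≤-pred y<N) (not-last refl)
      y<x+D (suc x) _ = s≤s (≤-trans (≤-pred y<N) (m≤n+m D x))

  forbidden⊎shortInnerChordless : ∀ d → HasForbidden G ⊎ ShortInnerChordless (2 + d)
  forbidden⊎shortInnerChordless zero = inj₂ λ i j _ 2+i≤j _ j<i+2 →
    ⊥-elim (<-irrefl refl (≤-trans j<i+2 (subst (_≤ j) (+-comm 2 i) 2+i≤j)))
  forbidden⊎shortInnerChordless (suc d) with forbidden⊎shortInnerChordless d
  ... | inj₁ forbidden = inj₁ forbidden
  ... | inj₂ chordless
    with allFalse⊎someTrue (λ i → (suc i + (2 + d) <ᵇ K) ∧ adj G (w (suc i)) (w (suc i + (2 + d)))) K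
  ...   | inj₁ none = inj₂ extended
    where
    extended : ShortInnerChordless (3 + d)
    extended (suc i) j 1≤i 2+i≤j j<K j<i+3+d with m≤n⇒m<n∨m≡n (≤-pred (subst (j <_) (+-suc (suc i) (2 + d)) j<i+3+d))
    ... | inj₁ j<i+2+d = chordless (suc i) j 1≤i 2+i≤j j<K j<i+2+d
    ... | inj₂ refl = ∧-false⇒falseʳ (<⇒<ᵇ-true j<K) (none i (<-trans (m≤m+n (suc i) _) j<K))
  ...   | inj₂ (i , found)
    with ∧-true (suc i + (2 + d) <ᵇ K) (adj G (w (suc i)) (w (suc i + (2 + d)))) found | even⊎odd d
  ...     | in-range , chord | inj₁ (t , refl) =
    inj₁ (forbidden-fromShortestChord (suc i) t (s≤s z≤n) (<ᵇ-true⇒< in-range) chordless chord)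
  ...     | in-range , chord | inj₂ (t , refl) =
    ⊥-elim (true≢false chord (noOddChord (suc i) t _ refl (<⇒≤ (<ᵇ-true⇒< in-range))))

  forbidden⊎innerChordless : HasForbidden G ⊎ InnerChordless
  forbidden⊎innerChordless with forbidden⊎shortInnerChordless K
  ... | inj₁ forbidden = inj₁ forbidden
  ... | inj₂ chordless = inj₂ λ i j 1≤i 2+i≤j j<K →
    chordless i j 1≤i 2+i≤j j<K (<-≤-trans j<K (≤-trans (m≤n+m K 2) (m≤n+m (2 + K) i)))

FanFirst : ∀ {n} → Graph n → ℕ → (ℕ → Fin n) → ℕ → Set
FanFirst G M w s = ∀ t → 1 ≤ t → t < M → adj G (w 0) (w (2 * t)) ≡ (t ≤ᵇ s)

FanLast : ∀ {n} → Graph n → ℕ → (ℕ → Fin n) → ℕ → Set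
FanLast G M w r = ∀ u → 1 ≤ u → u < M → adj G (w (2 * u)) (w (2 * M)) ≡ (r ≤ᵇ u)

module Chordless {n} {G : Graph n} {M} (2≤M : 2 ≤ M) {w : ℕ → Fin n} (W : EndLoopedWalk G M w)
  (chordless : InnerChords.InnerChordless 2≤M W) where
  open InnerChords 2≤M W public

  walk-injective : ∀ i j → i ≤ K → j ≤ K → w i ≡ w j → i ≡ j
  walk-injective i j i≤K j≤K = injective-from-< w (suc K) distinct i j (s≤s i≤K) (s≤s j≤K)
    where
    short : ShortInnerChordless K
    short i j 1≤i 2+i≤j j<K _ = chordless i j 1≤i 2+i≤j j<K

    distinct : ∀ i j → i < j → j < suc K → w i ≢ w j
    distinct i j i<j (s≤s j≤K) with m≤n⇒m<n∨m≡n j≤K | i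
    ... | inj₁ j<K | zero = λ e → inner≢first j i<j j<K (sym e)
    ... | inj₁ j<K | suc i′ = inner-injective short (suc i′) j (s≤s z≤n) i<j j<K (≤-trans (<⇒≤ j<K) (m≤n+m K (suc i′)))
    ... | inj₂ refl | zero = first≢last
    ... | inj₂ refl | suc i′ = inner≢last (suc i′) (s≤s z≤n) i<j

  first-nonadjacent-odd : ∀ t → 1 ≤ t → suc (2 * t) ≤ K → adj G (w 0) (w (suc (2 * t))) ≡ false
  first-nonadjacent-odd (suc t) _ ≤K = noOddChord 0 t _ (odd t) ≤K
    where
    odd : ∀ t → 3 + 2 * t ≡ suc (2 * suc t)
    odd = solve-∀

  last-nonadjacent-odd : ∀ t → 2 + 2 * t < K → adj G (w (suc (2 * t))) (w K) ≡ false
  last-nonadjacent-odd t 2+2t<K with ≤-split (*-cancelˡ-< 2 (suc t) M (subst (_< K) (double-suc t) 2+2t<K))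
    where
    double-suc : ∀ t → 2 + 2 * t ≡ 2 * suc t
    double-suc = solve-∀
  ... | c , refl = noOddChord (suc (2 * t)) c K (odd-length t c) ≤-refl
    where
    odd-length : ∀ t c → suc (2 * t) + (3 + 2 * c) ≡ 2 * (suc (suc t) + c)
    odd-length = solve-∀

  fanFirst-adj : ∀ {s} → FanFirst G M w s →
    ∀ j → 2 ≤ j → j < K → adj G (w 0) (w j) ≡ (evenᵇ j ∧ (j ≤ᵇ 2 * s))
  fanFirst-adj {s} fan j 2≤j j<K with even⊎odd j
  ... | inj₁ (suc t , refl) =
    trans (fan (suc t) (s≤s z≤n) (*-cancelˡ-< 2 (suc t) M j<K))
          (sym (trans (cong (_∧ (2 * suc t ≤ᵇ 2 * s)) (evenᵇ-double (suc t))) (≤ᵇ-double (suc t) s)))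
  ... | inj₂ (suc t , refl) =
    trans (first-nonadjacent-odd (suc t) (s≤s z≤n) (<⇒≤ j<K))
          (sym (cong (_∧ (suc (2 * suc t) ≤ᵇ 2 * s)) (evenᵇ-suc-double (suc t))))
  ... | inj₁ (zero , refl) = ⊥-elim (<⇒≱ 2≤j z≤n)
  ... | inj₂ (zero , refl) = ⊥-elim (<⇒≱ 2≤j (s≤s z≤n))

  fanLast-adj : ∀ {r} → FanLast G M w r →
    ∀ j → 1 ≤ j → suc j < K → adj G (w j) (w K) ≡ (evenᵇ j ∧ (2 * r ≤ᵇ j))
  fanLast-adj {r} fan j 1≤j 1+j<K with even⊎odd j
  ... | inj₁ (suc t , refl) =
    trans (fan (suc t) (s≤s z≤n) (*-cancelˡ-< 2 (suc t) M (<-trans (n<1+n _) 1+j<K)))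
          (sym (trans (cong (_∧ (2 * r ≤ᵇ 2 * suc t)) (evenᵇ-double (suc t))) (≤ᵇ-double r (suc t))))
  ... | inj₂ (t , refl) =
    trans (last-nonadjacent-odd t 1+j<K) (sym (cong (_∧ (2 * r ≤ᵇ suc (2 * t))) (evenᵇ-suc-double t)))
  ... | inj₁ (zero , refl) = ⊥-elim (<⇒≱ 1≤j z≤n)

  forbidden-F3-window : ∀ p L → 1 ≤ p → p + L < K → 3 ≤ L →
    adj G (w 0) (w p) ≡ true → adj G (w 0) (w (p + L)) ≡ true →
    (∀ j → p < j → j < p + L → adj G (w 0) (w j) ≡ false) → HasForbidden G
  forbidden-F3-window p L 1≤p p+L<K 3≤L adj-p adj-p+L between =
    F3 , N , s≤s (s≤s 3≤L) ,
    inducedCopy-fromCycle G F3 N g 3≤N g-injective g-edge adj-p+L g-loop g-nonConsecutive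
    where
    N : ℕ
    N = 2 + L

    3≤N : 3 ≤ N
    3≤N = s≤s (s≤s (≤-trans (s≤s z≤n) 3≤L))

    g : ℕ → Fin n
    g zero = w 0
    g (suc x) = w (p + x)

    p+x<K : ∀ {x} → x ≤ L → p + x < K
    p+x<K x≤L = ≤-<-trans (+-monoʳ-≤ p x≤L) p+L<K

    1≤p+x : ∀ x → 1 ≤ p + x
    1≤p+x x = ≤-trans 1≤p (m≤m+n p x)

    first≢inner : ∀ {x} → x ≤ L → w 0 ≢ w (p + x)
    first≢inner {x} x≤L e = <⇒≢ (1≤p+x x) (walk-injective 0 (p + x) z≤n (<⇒≤ (p+x<K x≤L)) e)

    g-injective : ∀ x y → x < N → y < N → g x ≡ g y → x ≡ y
    g-injective zero zero _ _ _ = refl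
    g-injective zero (suc y) _ (s≤s (s≤s y≤L)) e = ⊥-elim (first≢inner y≤L e)
    g-injective (suc x) zero (s≤s (s≤s x≤L)) _ e = ⊥-elim (first≢inner x≤L (sym e))
    g-injective (suc x) (suc y) (s≤s (s≤s x≤L)) (s≤s (s≤s y≤L)) e =
      cong suc (+-cancelˡ-≡ p x y (walk-injective (p + x) (p + y) (<⇒≤ (p+x<K x≤L)) (<⇒≤ (p+x<K y≤L)) e))

    g-edge : ∀ x → suc x < N → adj G (g x) (g (suc x)) ≡ true
    g-edge zero _ = subst (λ z → adj G (w 0) (w z) ≡ true) (sym (+-identityʳ p)) adj-p
    g-edge (suc x) (s≤s (s≤s 1+x≤L)) rewrite +-suc p x = edge (p + x) (p+x<K (≤-trans (n≤1+n x) 1+x≤L))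

    g-loop : ∀ x → x < N → adj G (g x) (g x) ≡ model F3 N x x
    g-loop zero _ = trans loop-first (sym (model-loop-first F3 N 3≤N (λ ())))
    g-loop (suc x) (s≤s (s≤s x≤L)) =
      trans (inner-loopless (p + x) (1≤p+x x) (p+x<K x≤L)) (sym (model-F3-loop-suc N x 3≤N))

    g-nonConsecutive : ∀ x y → NonConsecutive N x y → adj G (g x) (g y) ≡ model F3 N x y
    g-nonConsecutive zero (suc y) nc@(s≤s 1≤y , s≤s y<1+L , not-wrap) =
      trans (between (p + y) (subst (_< p + y) (+-identityʳ p) (+-monoʳ-< p 1≤y))
                     (+-monoʳ-< p (≤∧≢⇒< (≤-pred y<1+L) (λ e → not-wrap refl (cong suc e)))))
            (sym (model-F3-nonConsecutive nc))
    g-nonConsecutive (suc x) (suc y) nc@(s≤s 2+x≤y , s≤s y<1+L , _) =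
      trans (chordless (p + x) (p + y) (1≤p+x x) (+-monoʳ-2+≤ p 2+x≤y)
                       (p+x<K (≤-pred y<1+L)))
            (sym (model-F3-nonConsecutive nc))

  forbidden-fromGapAt : ∀ u t p → 1 ≤ p → 2 * u ≤ p → p ≤ suc (2 * u) → 2 + u ≤ t → t < M →
    adj G (w 0) (w p) ≡ true → adj G (w 0) (w (2 * t)) ≡ true →
    (∀ t′ → u < t′ → t′ < t → adj G (w 0) (w (2 * t′)) ≡ false) → HasForbidden G
  forbidden-fromGapAt u t p 1≤p 2u≤p p≤1+2u 2+u≤t t<M adj-p adj-2t gap =
    forbidden-F3-window p L 1≤p p+L<K 3≤L adj-p (subst (λ z → adj G (w 0) (w z) ≡ true) (sym p+L≡2t) adj-2t)
      between
    where
    3+p≤2t : 3 + p ≤ 2 * t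
    3+p≤2t = ≤-trans (+-monoʳ-≤ 3 p≤1+2u) (subst (_≤ 2 * t) (double-2+ u) (*-monoʳ-≤ 2 2+u≤t))
      where
      double-2+ : ∀ u → 2 * (2 + u) ≡ 3 + suc (2 * u)
      double-2+ = solve-∀

    L : ℕ
    L = 2 * t ∸ p

    p+L≡2t : p + L ≡ 2 * t
    p+L≡2t = m+[n∸m]≡n (≤-trans (m≤n+m p 3) 3+p≤2t)

    3≤L : 3 ≤ L
    3≤L = m+n≤o⇒m≤o∸n 3 3+p≤2t

    p+L<K : p + L < K
    p+L<K = subst (_< K) (sym p+L≡2t) (*-monoʳ-< 2 t<M)

    between : ∀ j → p < j → j < p + L → adj G (w 0) (w j) ≡ false
    between j p<j j<p+L with even⊎odd j
    ... | inj₁ (t′ , refl) =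
      gap t′ (*-cancelˡ-< 2 u t′ (≤-<-trans 2u≤p p<j)) (*-cancelˡ-< 2 t′ t (subst (2 * t′ <_) p+L≡2t j<p+L))
    ... | inj₂ (zero , refl) = ⊥-elim (<⇒≱ p<j 1≤p)
    ... | inj₂ (suc t′ , refl) = first-nonadjacent-odd (suc t′) (s≤s z≤n) (<⇒≤ (<-trans j<p+L p+L<K))

  forbidden-fromGap : ∀ u t → 2 + u ≤ t → t < M → (u ≡ 0 ⊎ adj G (w 0) (w (2 * u)) ≡ true) →
    adj G (w 0) (w (2 * t)) ≡ true →
    (∀ t′ → u < t′ → t′ < t → adj G (w 0) (w (2 * t′)) ≡ false) → HasForbidden G
  forbidden-fromGap zero t 2≤t t<M _ =
    forbidden-fromGapAt 0 t 1 ≤-refl z≤n ≤-refl 2≤t t<M edge-first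
  forbidden-fromGap (suc u) t 3+u≤t t<M (inj₂ adj-2u) =
    forbidden-fromGapAt (suc u) t (2 * suc u) (≤-trans (s≤s z≤n) (*-monoʳ-≤ 2 (s≤s (z≤n {u}))))
      ≤-refl (n≤1+n _) 3+u≤t t<M adj-2u

  FanFirstUpTo : ℕ → ℕ → Set
  FanFirstUpTo m s = s ≤ m × (∀ t → 1 ≤ t → t ≤ m → adj G (w 0) (w (2 * t)) ≡ (t ≤ᵇ s))

  forbidden⊎fanFirstUpTo : ∀ m → m < M → HasForbidden G ⊎ ∃ (FanFirstUpTo m)
  forbidden⊎fanFirstUpTo zero _ = inj₂ (0 , z≤n , λ t 1≤t t≤0 → ⊥-elim (<⇒≱ 1≤t t≤0))
  forbidden⊎fanFirstUpTo (suc m) 1+m<M with forbidden⊎fanFirstUpTo m (<-trans (n<1+n m) 1+m<M)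
  ... | inj₁ forbidden = inj₁ forbidden
  ... | inj₂ (s , s≤m , fan) with adj G (w 0) (w (2 * suc m)) in adj-next
  ...   | false = inj₂ (s , m≤n⇒m≤1+n s≤m , extended)
    where
    extended : ∀ t → 1 ≤ t → t ≤ suc m → adj G (w 0) (w (2 * t)) ≡ (t ≤ᵇ s)
    extended t 1≤t t≤1+m with m≤n⇒m<n∨m≡n t≤1+m
    ... | inj₁ t<1+m = fan t 1≤t (≤-pred t<1+m)
    ... | inj₂ refl = trans adj-next (sym (>⇒≤ᵇ-false (s≤s s≤m)))
  ...   | true with m≤n⇒m<n∨m≡n s≤m
  ...     | inj₂ refl = inj₂ (suc s , ≤-refl , extended)
    where
    extended : ∀ t → 1 ≤ t → t ≤ suc s → adj G (w 0) (w (2 * t)) ≡ (t ≤ᵇ suc s)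
    extended t 1≤t t≤1+s with m≤n⇒m<n∨m≡n t≤1+s
    ... | inj₁ (s≤s t≤s) = trans (fan t 1≤t t≤s) (trans (≤⇒≤ᵇ-true t≤s) (sym (≤⇒≤ᵇ-true (m≤n⇒m≤1+n t≤s))))
    ... | inj₂ refl = trans adj-next (sym (≤⇒≤ᵇ-true (≤-refl {suc s})))
  ...     | inj₁ s<m = inj₁ (forbidden-fromGap s (suc m) (s≤s s<m) 1+m<M start adj-next gap)
    where
    start : s ≡ 0 ⊎ adj G (w 0) (w (2 * s)) ≡ true
    start with s ≟ 0
    ... | yes s≡0 = inj₁ s≡0
    ... | no s≢0 = inj₂ (trans (fan s (n≢0⇒n>0 s≢0) s≤m) (≤⇒≤ᵇ-true (≤-refl {s})))

    gap : ∀ t′ → s < t′ → t′ < suc m → adj G (w 0) (w (2 * t′)) ≡ false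
    gap t′ s<t′ t′<1+m = trans (fan t′ (≤-trans (s≤s z≤n) s<t′) (≤-pred t′<1+m)) (>⇒≤ᵇ-false s<t′)

  M∸1<M : M ∸ 1 < M
  M∸1<M = ∸-monoʳ-< (s≤s z≤n) (≤-trans (s≤s z≤n) 2≤M)

  forbidden⊎fanFirst : HasForbidden G ⊎ ∃ λ s → s < M × FanFirst G M w s
  forbidden⊎fanFirst with forbidden⊎fanFirstUpTo (M ∸ 1) M∸1<M
  ... | inj₁ forbidden = inj₁ forbidden
  ... | inj₂ (s , s≤M∸1 , fan) = inj₂ (s , ≤-<-trans s≤M∸1 M∸1<M , λ t 1≤t t<M → fan t 1≤t (<⇒≤∸1 t<M))

  -- The cycle w 0, w P, w (P + 1), …, w (P + L), w K, of length 3 + L.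
  forbidden-endWindow : ∀ {F} → Bilooped F → ∀ P L → 1 ≤ P → P + L < K → 2 ≤ L → Admissible F (3 + L) →
    adj G (w 0) (w P) ≡ true → adj G (w (P + L)) (w K) ≡ true →
    (∀ y → NonConsecutive (3 + L) 0 (suc y) → y ≤ L → adj G (w 0) (w (P + y)) ≡ model F (3 + L) 0 (suc y)) →
    (∀ x → NonConsecutive (3 + L) (suc x) (2 + L) → adj G (w (P + x)) (w K) ≡ model F (3 + L) (suc x) (2 + L)) →
    HasForbidden G
  forbidden-endWindow {F} bilooped P L 1≤P P+L<K 2≤L admissible adj-P adj-P+L first-spokes last-spokes =
    F , N , admissible , inducedCopy-fromCycle G F N g 3≤N g-injective g-edge g-close g-loop g-nonConsecutive
    where
    N : ℕ
    N = 3 + L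

    3≤N : 3 ≤ N
    3≤N = s≤s (s≤s (s≤s z≤n))

    index : ℕ → ℕ
    index zero = 0
    index (suc x) = if x ≤ᵇ L then P + x else K

    g : ℕ → Fin n
    g x = w (index x)

    data Position : ℕ → Set where
      first : Position 0
      inner : ∀ x → x ≤ L → Position (suc x)
      last : Position (2 + L)

    position : ∀ y → y < N → Position y
    position zero _ = first
    position (suc y) (s≤s y<2+L) with m≤n⇒m<n∨m≡n y<2+L
    ... | inj₁ (s≤s (s≤s y≤L)) = inner y y≤L
    ... | inj₂ refl = last

    index-inner : ∀ x → x ≤ L → index (suc x) ≡ P + x
    index-inner x x≤L rewrite ≤⇒≤ᵇ-true x≤L = refl

    index-last : index (2 + L) ≡ K
    index-last rewrite >⇒≤ᵇ-false {suc L} {L} ≤-refl = refl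

    P+x<K : ∀ {x} → x ≤ L → P + x < K
    P+x<K x≤L = ≤-<-trans (+-monoʳ-≤ P x≤L) P+L<K

    1≤P+x : ∀ x → 1 ≤ P + x
    1≤P+x x = ≤-trans 1≤P (m≤m+n P x)

    index≤K : ∀ y → y < N → index y ≤ K
    index≤K y y<N with position y y<N
    ... | first = z≤n
    ... | inner x x≤L rewrite index-inner x x≤L = <⇒≤ (P+x<K x≤L)
    ... | last rewrite index-last = ≤-refl

    index-injective : ∀ x y → x < N → y < N → index x ≡ index y → x ≡ y
    index-injective x y x<N y<N e with position x x<N | position y y<N
    ... | first | first = refl
    ... | first | inner y′ y′≤L = ⊥-elim (<-irrefl (trans e (index-inner y′ y′≤L)) (1≤P+x y′))
    ... | first | last = ⊥-elim (<-irrefl (trans e index-last) (≤-trans (s≤s z≤n) 4≤K))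
    ... | inner x′ x′≤L | first = ⊥-elim (<-irrefl (trans (sym e) (index-inner x′ x′≤L)) (1≤P+x x′))
    ... | inner x′ x′≤L | inner y′ y′≤L =
      cong suc (+-cancelˡ-≡ P x′ y′ (trans (sym (index-inner x′ x′≤L)) (trans e (index-inner y′ y′≤L))))
    ... | inner x′ x′≤L | last =
      ⊥-elim (<-irrefl (trans (sym (index-inner x′ x′≤L)) (trans e index-last)) (P+x<K x′≤L))
    ... | last | first = ⊥-elim (<-irrefl (trans (sym e) index-last) (≤-trans (s≤s z≤n) 4≤K))
    ... | last | inner y′ y′≤L =
      ⊥-elim (<-irrefl (trans (sym (index-inner y′ y′≤L)) (trans (sym e) index-last)) (P+x<K y′≤L))
    ... | last | last = refl

    g-injective : ∀ x y → x < N → y < N → g x ≡ g y → x ≡ y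
    g-injective x y x<N y<N e =
      index-injective x y x<N y<N (walk-injective (index x) (index y) (index≤K x x<N) (index≤K y y<N) e)

    g-inner : ∀ x → x ≤ L → g (suc x) ≡ w (P + x)
    g-inner x x≤L = cong w (index-inner x x≤L)

    g-last : g (2 + L) ≡ w K
    g-last = cong w index-last

    g-edge : ∀ x → suc x < N → adj G (g x) (g (suc x)) ≡ true
    g-edge zero _ rewrite g-inner 0 z≤n | +-identityʳ P = adj-P
    g-edge (suc x) 2+x<N with position (2 + x) 2+x<N
    ... | inner .(suc x) 1+x≤L rewrite g-inner x (≤-trans (n≤1+n x) 1+x≤L) | g-inner (suc x) 1+x≤L | +-suc P x
      = edge (P + x) (P+x<K (≤-trans (n≤1+n x) 1+x≤L))
    ... | last rewrite g-inner L ≤-refl | g-last = adj-P+L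

    g-close : adj G (g 0) (g (N ∸ 1)) ≡ true
    g-close rewrite g-last = close

    g-loop : ∀ x → x < N → adj G (g x) (g x) ≡ model F N x x
    g-loop x x<N with position x x<N
    ... | first = trans loop-first (sym (model-loop-first F N 3≤N (F≢F2 bilooped)))
      where
      F≢F2 : ∀ {F} → Bilooped F → F ≢ F2
      F≢F2 F4-bilooped ()
      F≢F2 F6-bilooped ()
      F≢F2 F7-bilooped ()
    ... | inner x′ x′≤L rewrite g-inner x′ x′≤L =
      trans (inner-loopless (P + x′) (1≤P+x x′) (P+x<K x′≤L)) (sym (model-loop-inner bilooped N x′ 3≤N (s≤s (s≤s x′≤L))))
    ... | last rewrite g-last = trans loop-last (sym (model-loop-last bilooped N 3≤N))

    g-nonConsecutive : ∀ x y → NonConsecutive N x y → adj G (g x) (g y) ≡ model F N x y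
    g-nonConsecutive x y nc@(2+x≤y , y<N , not-wrap)
      with position x (<-trans (≤-trans (n≤1+n _) 2+x≤y) y<N) | position y y<N
    ... | first | first = ⊥-elim (<⇒≱ 2+x≤y z≤n)
    ... | first | inner y′ y′≤L rewrite g-inner y′ y′≤L = first-spokes y′ nc y′≤L
    ... | first | last = ⊥-elim (not-wrap refl refl)
    ... | inner x′ x′≤L | first = ⊥-elim (<⇒≱ 2+x≤y z≤n)
    ... | inner x′ x′≤L | inner y′ y′≤L rewrite g-inner x′ x′≤L | g-inner y′ y′≤L =
      trans (chordless (P + x′) (P + y′) (1≤P+x x′) (+-monoʳ-2+≤ P (≤-pred 2+x≤y)) (P+x<K y′≤L))
            (sym (model-inner-nonConsecutive bilooped nc (λ e → <-irrefl (suc-injective e) (s≤s y′≤L))))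
    ... | inner x′ x′≤L | last rewrite g-inner x′ x′≤L | g-last = last-spokes x′ nc
    ... | last | _ = ⊥-elim (<⇒≱ (≤-trans 2+x≤y (≤-pred y<N)) (n≤1+n _))

  forbidden-F4 : ∀ {s r} → FanFirst G M w s → FanLast G M w r →
    ∀ P Q → 1 ≤ P → 2 * s ≤ P → 2 + P ≤ Q → Q < K → Q ≤ 2 * r →
    adj G (w 0) (w P) ≡ true → adj G (w Q) (w K) ≡ true → HasForbidden G
  forbidden-F4 {s} {r} fanFirst fanLast P Q 1≤P 2s≤P 2+P≤Q Q<K Q≤2r adj-P adj-Q =
    forbidden-endWindow F4-bilooped P L 1≤P P+L<K 2≤L (s≤s (s≤s (s≤s 2≤L))) adj-P adj-P+L first-spokes last-spokes
    where
    L : ℕ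
    L = Q ∸ P
    N : ℕ
    N = 3 + L

    P+L≡Q : P + L ≡ Q
    P+L≡Q = m+[n∸m]≡n (≤-trans (m≤n+m P 2) 2+P≤Q)

    2≤L : 2 ≤ L
    2≤L = m+n≤o⇒m≤o∸n 2 2+P≤Q

    P+L<K : P + L < K
    P+L<K = subst (_< K) (sym P+L≡Q) Q<K

    adj-P+L : adj G (w (P + L)) (w K) ≡ true
    adj-P+L = subst (λ z → adj G (w z) (w K) ≡ true) (sym P+L≡Q) adj-Q

    first-spokes : ∀ y → NonConsecutive N 0 (suc y) → y ≤ L → adj G (w 0) (w (P + y)) ≡ model F4 N 0 (suc y)
    first-spokes y nc@(s≤s 1≤y , _) y≤L =
      trans (fanFirst-adj {s} fanFirst (P + y) (+-mono-≤ 1≤P 1≤y) (≤-<-trans (+-monoʳ-≤ P y≤L) P+L<K))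
            (trans (∧-falseʳ _ (>⇒≤ᵇ-false (≤-<-trans 2s≤P (subst (_< P + y) (+-identityʳ P) (+-monoʳ-< P 1≤y)))))
                   (sym (model-F4-nonConsecutive nc)))

    last-spokes : ∀ x → NonConsecutive N (suc x) (2 + L) → adj G (w (P + x)) (w K) ≡ model F4 N (suc x) (2 + L)
    last-spokes x nc@(s≤s (s≤s 1+x≤L) , _) =
      trans (fanLast-adj {r} fanLast (P + x) (≤-trans 1≤P (m≤m+n P x))
               (≤-<-trans (subst (_≤ P + L) (+-suc P x) (+-monoʳ-≤ P 1+x≤L)) P+L<K))
            (trans (∧-falseʳ _ (>⇒≤ᵇ-false (<-≤-trans (+-monoʳ-< P 1+x≤L) (subst (_≤ 2 * r) (sym P+L≡Q) Q≤2r))))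
                   (sym (model-F4-nonConsecutive nc)))

  forbidden-F6 : ∀ {s r} → FanFirst G M w s → FanLast G M w r →
    ∀ L → 2 ≤ L → 1 + L < K → 1 + L ≤ 2 * r → L ≤ 2 * s →
    adj G (w (1 + L)) (w K) ≡ true → HasForbidden G
  forbidden-F6 {s} {r} fanFirst fanLast L 2≤L 1+L<K 1+L≤2r L≤2s adj-1+L =
    forbidden-endWindow F6-bilooped 1 L ≤-refl 1+L<K 2≤L (s≤s (s≤s (s≤s 2≤L)))
      edge-first adj-1+L first-spokes last-spokes
    where
    N : ℕ
    N = 3 + L

    first-spokes : ∀ y → NonConsecutive N 0 (suc y) → y ≤ L → adj G (w 0) (w (1 + y)) ≡ model F6 N 0 (suc y)
    first-spokes y nc@(s≤s 1≤y , _) y≤L =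
      trans (fanFirst-adj {s} fanFirst (1 + y) (s≤s 1≤y) (≤-<-trans (s≤s y≤L) 1+L<K))
            (trans (evenᵇ-∧-≤ᵇ-double (suc y) s (s≤s (≤-trans y≤L L≤2s))) (sym (model-F6-nonConsecutive-zero nc)))

    last-spokes : ∀ x → NonConsecutive N (suc x) (2 + L) → adj G (w (1 + x)) (w K) ≡ model F6 N (suc x) (2 + L)
    last-spokes x nc@(s≤s (s≤s 1+x≤L) , _) =
      trans (fanLast-adj {r} fanLast (1 + x) (s≤s z≤n) (≤-<-trans (s≤s 1+x≤L) 1+L<K))
            (trans (∧-falseʳ _ (>⇒≤ᵇ-false (<-≤-trans (s≤s 1+x≤L) 1+L≤2r))) (sym (model-F6-nonConsecutive-suc nc)))

  forbidden-F7 : ∀ {s} → FanFirst G M w s → FanLast G M w 1 → ∀ L → 2 + L ≡ K → L ≤ 2 * s → HasForbidden G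
  forbidden-F7 {s} fanFirst fanLast L 2+L≡K L≤2s =
    forbidden-endWindow F7-bilooped 1 L ≤-refl 1+L<K 2≤L (s≤s (s≤s (s≤s 2≤L)))
      edge-first adj-1+L first-spokes last-spokes
    where
    N : ℕ
    N = 3 + L

    1+L<K : 1 + L < K
    1+L<K = subst (1 + L <_) 2+L≡K ≤-refl

    2≤L : 2 ≤ L
    2≤L = ≤-pred (≤-pred (subst (4 ≤_) (sym 2+L≡K) 4≤K))

    adj-1+L : adj G (w (1 + L)) (w K) ≡ true
    adj-1+L = subst (λ z → adj G (w (1 + L)) (w z) ≡ true) 2+L≡K (edge (1 + L) 1+L<K)

    first-spokes : ∀ y → NonConsecutive N 0 (suc y) → y ≤ L → adj G (w 0) (w (1 + y)) ≡ model F7 N 0 (suc y)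
    first-spokes y nc@(s≤s 1≤y , _) y≤L =
      trans (fanFirst-adj {s} fanFirst (1 + y) (s≤s 1≤y) (≤-<-trans (s≤s y≤L) 1+L<K))
            (trans (evenᵇ-∧-≤ᵇ-double (suc y) s (s≤s (≤-trans y≤L L≤2s))) (sym (model-F7-nonConsecutive-zero nc)))

    last-spokes : ∀ x → NonConsecutive N (suc x) (2 + L) → adj G (w (1 + x)) (w K) ≡ model F7 N (suc x) (2 + L)
    last-spokes x nc@(s≤s (s≤s 1+x≤L) , _) =
      trans (fanLast-adj {1} fanLast (1 + x) (s≤s z≤n) (≤-<-trans (s≤s 1+x≤L) 1+L<K))
            (trans (evenᵇ-∧-2≤ᵇ (suc x) (s≤s z≤n))
                   (sym (trans (trans (model-F7-nonConsecutive-suc nc) (hubLast-nonConsecutive-last nc))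
                               (trans (cong (λ z → evenᵇ (z ∸ suc x)) 2+L≡K)
                                      (evenᵇ-∸-double M (suc x) (<⇒≤ (<-trans (n<1+n (suc x)) (≤-<-trans (s≤s 1+x≤L) 1+L<K))))))))

  2+2[M∸1]≡K : 2 + 2 * (M ∸ 1) ≡ K
  2+2[M∸1]≡K = trans (sym (*-distribˡ-+ 2 1 (M ∸ 1))) (cong (2 *_) (m+[n∸m]≡n (≤-trans (s≤s z≤n) 2≤M)))

  1+2[M∸1]<K : 1 + 2 * (M ∸ 1) < K
  1+2[M∸1]<K = ≤-reflexive 2+2[M∸1]≡K

  edge-last : adj G (w (1 + 2 * (M ∸ 1))) (w K) ≡ true
  edge-last = subst (λ z → adj G (w (1 + 2 * (M ∸ 1))) (w z) ≡ true) 2+2[M∸1]≡K (edge (1 + 2 * (M ∸ 1)) 1+2[M∸1]<K)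

  fanFirst-anchor : ∀ {s} → FanFirst G M w s → ∀ t → 1 ≤ t → t < M → t ≤ s → adj G (w 0) (w (2 * t)) ≡ true
  fanFirst-anchor {s} fan t 1≤t t<M t≤s = trans (fan t 1≤t t<M) (≤⇒≤ᵇ-true t≤s)

  fanLast-anchor : ∀ {r} → FanLast G M w r → ∀ u → 1 ≤ u → u < M → r ≤ u → adj G (w (2 * u)) (w K) ≡ true
  fanLast-anchor {r} fan u 1≤u u<M r≤u = trans (fan u 1≤u u<M) (≤⇒≤ᵇ-true r≤u)

  forbidden-F6-short : ∀ {s r} → FanFirst G M w s → FanLast G M w r → s < M → 2 ≤ r → r ≤ s → HasForbidden G
  forbidden-F6-short {s} {suc r′} fanFirst fanLast s<M (s≤s 1≤r′) 1+r′≤s =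
    forbidden-F6 {s} {suc r′} fanFirst fanLast L (s≤s (≤-trans 1≤r′ (m≤m+n r′ _))) 1+L<K (≤-reflexive 1+L≡2r)
      (≤-trans (n≤1+n L) (subst (_≤ 2 * s) (sym 1+L≡2r) (*-monoʳ-≤ 2 1+r′≤s)))
      (subst (λ z → adj G (w z) (w K) ≡ true) (sym 1+L≡2r)
        (fanLast-anchor {suc r′} fanLast (suc r′) (s≤s z≤n) (≤-<-trans 1+r′≤s s<M) ≤-refl))
    where
    L : ℕ
    L = suc (2 * r′)

    1+L≡2r : 1 + L ≡ 2 * suc r′
    1+L≡2r = sym (+-suc (suc r′) (r′ + 0))

    1+L<K : 1 + L < K
    1+L<K = subst (_< K) (sym 1+L≡2r) (*-monoʳ-< 2 (≤-<-trans 1+r′≤s s<M))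

  forbidden-F6-long : FanFirst G M w (M ∸ 1) → FanLast G M w M → HasForbidden G
  forbidden-F6-long fanFirst fanLast =
    forbidden-F6 {M ∸ 1} {M} fanFirst fanLast (2 * (M ∸ 1)) (*-monoʳ-≤ 2 (m+n≤o⇒m≤o∸n 1 2≤M))
      1+2[M∸1]<K (<⇒≤ 1+2[M∸1]<K) ≤-refl edge-last

  forbidden-F4-fromFans : ∀ {s r} → FanFirst G M w s → FanLast G M w r →
    s < r → s < M ∸ 1 → 2 ≤ r → r ≤ M → HasForbidden G
  forbidden-F4-fromFans {s} {r} fanFirst fanLast s<r s<M∸1 2≤r r≤M with s ≟ 0 | r ≟ M
  ... | yes refl | yes refl =
    forbidden-F4 {s} {r} fanFirst fanLast 1 (1 + 2 * (M ∸ 1)) ≤-refl z≤n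
      (s≤s (*-monoʳ-≤ 2 (m+n≤o⇒m≤o∸n 1 2≤M))) 1+2[M∸1]<K (<⇒≤ 1+2[M∸1]<K) edge-first edge-last
  ... | yes refl | no r≢M =
    forbidden-F4 {s} {r} fanFirst fanLast 1 (2 * r) ≤-refl z≤n
      (≤-trans (n≤1+n 3) (*-monoʳ-≤ 2 2≤r)) (*-monoʳ-< 2 r<M) ≤-refl
      edge-first (fanLast-anchor {r} fanLast r (≤-trans (s≤s z≤n) 2≤r) r<M ≤-refl)
    where
    r<M : r < M
    r<M = ≤∧≢⇒< r≤M r≢M
  ... | no s≢0 | yes refl =
    forbidden-F4 {s} {r} fanFirst fanLast (2 * s) (1 + 2 * (M ∸ 1))
      (≤-trans (n≤1+n 1) (*-monoʳ-≤ 2 (n≢0⇒n>0 s≢0))) ≤-refl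
      (m≤n⇒m≤1+n (subst (_≤ 2 * (M ∸ 1)) (*-distribˡ-+ 2 1 s) (*-monoʳ-≤ 2 s<M∸1)))
      1+2[M∸1]<K (<⇒≤ 1+2[M∸1]<K)
      (fanFirst-anchor {s} fanFirst s (n≢0⇒n>0 s≢0) (<-trans s<M∸1 M∸1<M) ≤-refl) edge-last
  ... | no s≢0 | no r≢M =
    forbidden-F4 {s} {r} fanFirst fanLast (2 * s) (2 * r)
      (≤-trans (n≤1+n 1) (*-monoʳ-≤ 2 (n≢0⇒n>0 s≢0))) ≤-refl
      (subst (_≤ 2 * r) (*-distribˡ-+ 2 1 s) (*-monoʳ-≤ 2 s<r)) (*-monoʳ-< 2 r<M) ≤-refl
      (fanFirst-anchor {s} fanFirst s (n≢0⇒n>0 s≢0) (<-trans s<M∸1 M∸1<M) ≤-refl)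
      (fanLast-anchor {r} fanLast r (≤-trans (s≤s z≤n) 2≤r) r<M ≤-refl)
    where
    r<M : r < M
    r<M = ≤∧≢⇒< r≤M r≢M

  forbidden-fromFans : ∀ {s r} → FanFirst G M w s → FanLast G M w r → s < M → 1 ≤ r → r ≤ M →
    (r ≡ 1 → s ≡ M ∸ 1) → HasForbidden G
  forbidden-fromFans {s} {r} fanFirst fanLast s<M 1≤r r≤M r≡1⇒s≡M∸1 with 2 ≤? r
  ... | no r≱2 with ≤-antisym (≤-pred (≰⇒> r≱2)) 1≤r
  ...   | refl with r≡1⇒s≡M∸1 refl
  ...     | refl = forbidden-F7 {M ∸ 1} fanFirst fanLast (2 * (M ∸ 1)) 2+2[M∸1]≡K ≤-refl
  forbidden-fromFans {s} {r} fanFirst fanLast s<M 1≤r r≤M r≡1⇒s≡M∸1 | yes 2≤r with r ≤? s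
  ... | yes r≤s = forbidden-F6-short {s} {r} fanFirst fanLast s<M 2≤r r≤s
  ... | no r≰s with s ≟ M ∸ 1
  ...   | no s≢M∸1 =
    forbidden-F4-fromFans {s} {r} fanFirst fanLast (≰⇒> r≰s) (≤∧≢⇒< (<⇒≤∸1 s<M) s≢M∸1) 2≤r r≤M
  ...   | yes refl with ≤-antisym r≤M (subst (_≤ r) (m+[n∸m]≡n (≤-trans (s≤s z≤n) 2≤M)) (≰⇒> r≰s))
  ...     | refl = forbidden-F6-long fanFirst fanLast

fanFirst⇒fanLast-reversed : ∀ {n} {G : Graph n} {M} {w w′ : ℕ → Fin n} →
  (∀ i → i ≤ 2 * M → w′ i ≡ w (2 * M ∸ i)) → ∀ {s} → FanFirst G M w s → FanLast G M w′ (M ∸ s)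
fanFirst⇒fanLast-reversed {G = G} {M} {w} {w′} w′≡w∘reverse {s} fan u 1≤u u<M = begin
  adj G (w′ (2 * u)) (w′ (2 * M))
    ≡⟨ cong₂ (adj G) (w′≡w∘reverse (2 * u) (*-monoʳ-≤ 2 (<⇒≤ u<M))) (w′≡w∘reverse (2 * M) ≤-refl) ⟩
  adj G (w (2 * M ∸ 2 * u)) (w (2 * M ∸ 2 * M))
    ≡⟨ cong₂ (λ a b → adj G (w a) (w b)) (sym (*-distribˡ-∸ 2 M u)) (n∸n≡0 (2 * M)) ⟩
  adj G (w (2 * (M ∸ u))) (w 0)
    ≡⟨ adj-sym G _ _ ⟩
  adj G (w 0) (w (2 * (M ∸ u)))
    ≡⟨ fan (M ∸ u) (m<n⇒0<n∸m u<M) (∸-monoʳ-< 1≤u (<⇒≤ u<M)) ⟩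
  ((M ∸ u) ≤ᵇ s)
    ≡⟨ ∸-≤ᵇ-swap M u s ⟩
  ((M ∸ s) ≤ᵇ u)
    ∎
  where open ≡-Reasoning

-- The forward case analysis fails only for r = 1 and s < M - 1; after reversing the walk
-- that configuration becomes s′ = M - 1 with r′ = M - s ≥ 2, which it handles.
module BothFans {n} {G : Graph n} {M} (2≤M : 2 ≤ M) {w : ℕ → Fin n} (W : EndLoopedWalk G M w)
  (chordless : InnerChords.InnerChordless 2≤M W)
  (chordless′ : InnerChords.InnerChordless 2≤M (reverseWalk W))
  {s s′ : ℕ} (fan : FanFirst G M w s) (fan′ : FanFirst G M (λ i → w (2 * M ∸ i)) s′)
  (s<M : s < M) (s′<M : s′ < M) where

  forward : (M ∸ s′ ≡ 1 → s ≡ M ∸ 1) → HasForbidden G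
  forward = Chordless.forbidden-fromFans 2≤M W chordless {s} {M ∸ s′} fan
    (fanFirst⇒fanLast-reversed {G = G} {M} {w = λ i → w (2 * M ∸ i)} {w}
      (λ i i≤K → cong w (sym (m∸[m∸n]≡n i≤K))) fan′)
    s<M (m<n⇒0<n∸m s′<M) (m∸n≤m M s′)

  backward : (M ∸ s ≡ 1 → s′ ≡ M ∸ 1) → HasForbidden G
  backward = Chordless.forbidden-fromFans 2≤M (reverseWalk W) chordless′ {s′} {M ∸ s} fan′
    (fanFirst⇒fanLast-reversed {G = G} {M} {w = w} {λ i → w (2 * M ∸ i)} (λ _ _ → refl) fan)
    s′<M (m<n⇒0<n∸m s<M) (m∸n≤m M s)

  forbidden : HasForbidden G
  forbidden with M ∸ s′ ≟ 1 | s ≟ M ∸ 1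
  ... | _ | yes s≡M∸1 = forward (λ _ → s≡M∸1)
  ... | no r≢1 | no _ = forward (λ r≡1 → ⊥-elim (r≢1 r≡1))
  ... | yes _ | no s≢M∸1 = backward (λ M∸s≡1 → ⊥-elim (s≢M∸1 (∸≡1⇒≡∸1 (<⇒≤ s<M) M∸s≡1)))

forbidden-fromEndLoopedWalk : ∀ {n} {G : Graph n} {M} {w : ℕ → Fin n} → 2 ≤ M → EndLoopedWalk G M w → HasForbidden G
forbidden-fromEndLoopedWalk 2≤M W
  with InnerChords.forbidden⊎innerChordless 2≤M W | InnerChords.forbidden⊎innerChordless 2≤M (reverseWalk W)
... | inj₁ forbidden | _ = forbidden
... | inj₂ _ | inj₁ forbidden = forbidden
... | inj₂ chordless | inj₂ chordless′
  with Chordless.forbidden⊎fanFirst 2≤M W chordless | Chordless.forbidden⊎fanFirst 2≤M (reverseWalk W) chordless′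
... | inj₁ forbidden | _ = forbidden
... | inj₂ _ | inj₁ forbidden = forbidden
... | inj₂ (s , s<M , fan) | inj₂ (s′ , s′<M , fan′) =
  BothFans.forbidden 2≤M W chordless chordless′ fan fan′ s<M s′<M

lemma8 : ∀ {n} (G : Graph n) (k : ℕ) (w : ℕ → Fin n) →
    Odd k → 3 < k →
    IsWalk G k w → w k ≡ w 0 →
    NoStrongChord G (k ∸ 1) w →
    adj G (w 0) (w 0) ≡ true → adj G (w (k ∸ 1)) (w (k ∸ 1)) ≡ true →
    (∀ i → i ≤ k → adj G (w i) (w i) ≡ true → w i ≡ w 0 ⊎ w i ≡ w (k ∸ 1)) →
    HasForbidden G
lemma8 G .(suc (2 * M)) w (M , refl) 3<k walk closed noStrongChord loop-first loop-last loops-at-ends =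
  forbidden-fromEndLoopedWalk {G = G} {M} {w} (2≤M M 3<k) record
    { edge = λ i i<K → walk i (m≤n⇒m≤1+n i<K)
    ; close = trans (adj-sym G _ _) (subst (λ z → adj G (w (2 * M)) z ≡ true) closed (walk (2 * M) ≤-refl))
    ; noStrongChord = noStrongChord
    ; loop-first = loop-first
    ; loop-last = loop-last
    ; loops-at-ends = λ i i≤K → loops-at-ends i (m≤n⇒m≤1+n i≤K)
    }
  where
  2≤M : ∀ M → 3 < suc (2 * M) → 2 ≤ M
  2≤M (suc (suc M)) _ = s≤s (s≤s z≤n)
  2≤M (suc zero) (s≤s (s≤s (s≤s ())))
  2≤M zero (s≤s ())
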